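{- Let $n\ge1$, $m\ge2$, $\Sigma=\{M_0,\dots,M_{2^m-1}\}\subseteq\mathbb{R}^{n\times n}$, and let $k$, $B$, $e_j$, $e'_j$, $\tau$ be as in the context. Let $i\in\{1,\dots,n\}$ and write $A_t=A_t(B,e_1+e_{k+i})$. For any integer $t>3m$ such that $t-1$ is not divisible by $3m$, $A_t=\{0\}$. Moreover, for any integer $r\ge1$, $$A_{3mr+1}=\{\tau(Ne'_i): N\in\Sigma^r\}\cup\{0\}.$$
   Context: Let $S_i=2^{i+1}+1$ for $i\ge0$ and $k=S_m-1=2^{m+1}$. For $x\in\mathbb{R}^{k+n}$, $x_j$ is its $j$th coordinate and $\pi(x)\in\mathbb{R}^n$ is given by $\pi(x)_j=x_{k+j}$. For $x\in\mathbb{R}^n$, $\tau(x)\in\mathbb{R}^{k+n}$ has its first $k$ coordinates equal to $0$ and $\tau(x)_{k+j}=x_j$. Let $e_1,\dots,e_{k+n}$ and $e'_1,\dots,e'_n$ be the canonical bases of $\mathbb{R}^{k+n}$ and $\mathbb{R}^n$. Define the bilinear map $B:\mathbb{R}^{k+n}\times\mathbb{R}^{k+n}\to\mathbb{R}^{k+n}$ by: $B(x,y)_1=0$, $B(x,y)_2=x_1y_1$, $B(x,y)_3=x_1y_2$, $B(x,y)_4=x_2y_1$; for all $i\in\{1,\dots,m-1\}$ and $j\in\{0,\dots,2^i-1\}$, $B(x,y)_{2j+S_i}=x_{j+S_{i-1}}y_3$ and $B(x,y)_{2j+1+S_i}=x_{j+S_{i-1}}y_4$; and $\pi(B(x,y))=\sum_{i=0}^{2^m-1}y_{i+S_{m-1}}M_i\pi(x)$.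 For $v\in\mathbb{R}^{k+n}$, $A_1(B,v)=\{v\}$ and for $t\ge2$, $A_t(B,v)=\bigcup_{1\le m'\le t-1}\{B(x,y): x\in A_{m'}(B,v),\ y\in A_{t-m'}(B,v)\}$. $\Sigma^r=\{N_1\cdots N_r: N_j\in\Sigma\}$. -}

module Defs where

open import Level using (_⊔_)
open import Algebra.Bundles using (CommutativeRing)
open import Data.Nat using (ℕ; zero; suc; _+_; _*_; _∸_; _^_; _<?_)
open import Data.Fin using (Fin; toℕ; fromℕ<; splitAt; _↑ʳ_)
open import Data.Vec using (Vec; []; _∷_)
open import Data.Product using (Σ; _×_; ∃)
open import Data.Sum using (_⊎_; inj₁; inj₂)
open import Relation.Nullary using (yes; no)
open import Data.Bool using (if_then_else_)
open import Data.Nat using (_≡ᵇ_)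

S : ℕ → ℕ
S i = 2 ^ suc i + 1

-- k = S m - 1 = 2^(m+1)
kOf : ℕ → ℕ
kOf m = 2 ^ suc m

module WithRing {c ℓ} (R : CommutativeRing c ℓ) where
  open CommutativeRing R using (Carrier; _≈_; 0#; 1#) renaming (_+_ to _+ᴿ_; _*_ to _*ᴿ_)

  -- vectors in R^N, as functions on Fin N (0-based positions)
  Vecᴿ : ℕ → Set c
  Vecᴿ N = Fin N → Carrier

  _≈ᵛ_ : ∀ {N} → Vecᴿ N → Vecᴿ N → Set ℓ
  x ≈ᵛ y = ∀ j → x j ≈ y j

  0ᵛ : ∀ {N} → Vecᴿ N
  0ᵛ _ = 0#

  _+ᵛ_ : ∀ {N} → Vecᴿ N → Vecᴿ N → Vecᴿ N
  (x +ᵛ y) j = x j +ᴿ y j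

  -- 1-based coordinate access x_p (paper's notation); 0 outside 1..N
  -- (only ever used with indices in range).
  _!_ : ∀ {N} → Vecᴿ N → ℕ → Carrier
  _!_ x zero = 0#
  _!_ {N} x (suc q) with q <? N
  ... | yes q<N = x (fromℕ< q<N)
  ... | no _ = 0#

  e : ∀ {N} → ℕ → Vecᴿ N
  e p j = if suc (toℕ j) ≡ᵇ p then 1# else 0#

  e′ : ∀ {n} → Fin n → Vecᴿ n
  e′ i = e (suc (toℕ i))

  sumF : ∀ {n} → (Fin n → Carrier) → Carrier
  sumF {zero} f = 0#
  sumF {suc n} f = f Fin.zero +ᴿ sumF (λ j → f (Fin.suc j))
    where import Data.Fin as Fin

  Mat : ℕ → Set c
  Mat n = Fin n → Fin n → Carrier

  matVec : ∀ {n} → Mat n → Vecᴿ n → Vecᴿ n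
  matVec A x a = sumF (λ b → A a b *ᴿ x b)

  matMul : ∀ {n} → Mat n → Mat n → Mat n
  matMul A C a b = sumF (λ d → A a d *ᴿ C d b)

  idM : ∀ {n} → Mat n
  idM a b = e (suc (toℕ a)) b

  wordProd : ∀ {s n r} → (Fin s → Mat n) → Vec (Fin s) r → Mat n
  wordProd M [] = idM
  wordProd M (a ∷ w) = matMul (M a) (wordProd M w)

  π : ∀ {k n} → Vecᴿ (k + n) → Vecᴿ n
  π {k} x j = x (k ↑ʳ j)

  τ : ∀ {k n} → Vecᴿ n → Vecᴿ (k + n)
  τ {k} x c with splitAt k c
  ... | inj₁ _ = 0#
  ... | inj₂ j = x j

  -- B is the bilinear map of the paper, specified coordinatewise (1-based indices).
  IsB : (m n : ℕ) → (Fin (2 ^ m) → Mat n) →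
        (Vecᴿ (kOf m + n) → Vecᴿ (kOf m + n) → Vecᴿ (kOf m + n)) → Set (c ⊔ ℓ)
  IsB m n M B = ∀ x y →
      (B x y ! 1 ≈ 0#)
    × (B x y ! 2 ≈ (x ! 1) *ᴿ (y ! 1))
    × (B x y ! 3 ≈ (x ! 1) *ᴿ (y ! 2))
    × (B x y ! 4 ≈ (x ! 2) *ᴿ (y ! 1))
    × (∀ i j → 1 Data.Nat.≤ i → i Data.Nat.≤ m ∸ 1 → j Data.Nat.< 2 ^ i →
         (B x y ! (2 * j + S i) ≈ (x ! (j + S (i ∸ 1))) *ᴿ (y ! 3))
       × (B x y ! (2 * j + 1 + S i) ≈ (x ! (j + S (i ∸ 1))) *ᴿ (y ! 4)))
    × (π {kOf m} (B x y) ≈ᵛ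
         (λ j → sumF (λ (a : Fin (2 ^ m)) →
                  (y ! (toℕ a + S (m ∸ 1))) *ᴿ matVec (M a) (π {kOf m} x) j)))
    where import Data.Nat

  -- A_t(B,v) as an inductive predicate: A_1 = {v},
  -- A_t = ⋃_{1≤m'≤t-1} B(A_{m'}, A_{t-m'}).
  data InA {N} (B : Vecᴿ N → Vecᴿ N → Vecᴿ N) (v : Vecᴿ N) : ℕ → Vecᴿ N → Set c where
    base : InA B v 1 v
    step : ∀ {p q x y} → InA B v (suc p) x → InA B v (suc q) y →
           InA B v (suc p + suc q) (B x y)

  SetEq : ∀ {N a b} → (Vecᴿ N → Set a) → (Vecᴿ N → Set b) → Set (c ⊔ ℓ ⊔ a ⊔ b)
  SetEq {N} P Q = (∀ z → P z → Q z) × (∀ z → Q z → Σ (Vecᴿ N) λ z′ → P z′ × (z′ ≈ᵛ z))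

  IsZero : ∀ {N} → Vecᴿ N → Set ℓ
  IsZero z = z ≈ᵛ 0ᵛ

  Target : (m n : ℕ) → (Fin (2 ^ m) → Mat n) → Fin n → ℕ → Vecᴿ (kOf m + n) → Set ℓ
  Target m n M i r z =
    (Σ (Vec (Fin (2 ^ m)) r) λ w → z ≈ᵛ τ {kOf m} (matVec (wordProd M w) (e′ i)))
    ⊎ (z ≈ᵛ 0ᵛ)

  start : (m n : ℕ) → Fin n → Vecᴿ (kOf m + n)
  start m n i = e 1 +ᵛ e (kOf m + suc (toℕ i))

-- Read the coordinates 1, …, k of R^(k+n) as a binary tree.  The start vector v = e₁ + τ(e′ᵢ) is the
-- root, B(v,v) = e₂, B(v,e₂) = e₃ and B(e₂,v) = e₄, and multiplying a node e_p (p ≥ 3) on the right by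
-- e₃ or e₄ moves it to its children e_(2p−1), e_(2p); so a node of level l, 2^(l+1) < p ≤ 2^(l+2),
-- appears after 3(l+1) steps.  The leaves (level m−1, reached after 3m steps) are the coordinates that
-- B reads as the weights of M₀, …, M_(2^m−1), so multiplying by the leaf of M_a sends x to τ(M_a π x).
-- Tracking the first k coordinates and the tail π of every vector shows that each element of A_t is 0,
-- v (t = 1), e₂ (t = 2), a node (t = 3(l+1)) or τ(N e′ᵢ) with N ∈ Σ^r (t = 3mr + 1), since this list is
-- closed under B; conversely each of these vectors, and 0 for every t ≥ 4, does occur.
module Submission where

open import Level using (_⊔_)
open import Algebra.Bundles using (CommutativeRing)
open import Data.Bool using (true; false; if_then_else_)
open import Data.Empty using (⊥-elim)
open import Data.Fin using (Fin; toℕ; fromℕ<; splitAt; _↑ʳ_) renaming (zero to fzero; suc to fsuc)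
open import Data.Fin.Properties using (toℕ-fromℕ<; fromℕ<-toℕ; toℕ-↑ʳ; toℕ-↑ˡ; toℕ<n; toℕ-injective; suc-injective; splitAt-↑ʳ; splitAt⁻¹-↑ˡ; splitAt⁻¹-↑ʳ)
open import Data.Nat using (ℕ; zero; suc; _+_; _*_; _∸_; _^_; _≤_; _<_; s≤s; z≤n; _≡ᵇ_; _<?_; _≟_; _≤?_)
import Data.Nat.Properties as ℕₚ
open import Data.Nat.Divisibility using (_∣_; m∣m*n)
open import Data.Nat.Solver using (module +-*-Solver)
open import Data.Product using (Σ; _,_; _×_; proj₁; proj₂)
open import Data.Sum using (inj₁; inj₂)
open import Data.Vec using (Vec; []; _∷_)
open import Function using (_∘_)
open import Relation.Nullary using (¬_; Dec; yes; no)
open import Relation.Nullary.Decidable using (True; toWitness)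
open import Relation.Binary.PropositionalEquality as ≡ using (_≡_; _≢_; cong; cong₂; subst; subst₂)
open import Defs

module RingVectors {c ℓ} (R : CommutativeRing c ℓ) where
  open CommutativeRing R renaming (_+_ to _+ᴿ_; _*_ to _*ᴿ_)
  open WithRing R
  open import Algebra.Properties.CommutativeSemigroup +-commutativeSemigroup using (interchange)
  open import Relation.Binary.Reasoning.Setoid setoid

  δ : ℕ → ℕ → Carrier
  δ r q = if q ≡ᵇ r then 1# else 0#

  δ-diag : ∀ r → δ r r ≈ 1#
  δ-diag r with r ≡ᵇ r | ℕₚ.≡⇒≡ᵇ r r ≡.refl
  ... | true | _ = refl

  δ-off : ∀ {r q} → q ≢ r → δ r q ≈ 0#
  δ-off {r} {q} q≢r with q ≡ᵇ r | ℕₚ.≡ᵇ⇒≡ q r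
  ... | false | _ = refl
  ... | true | q≡r = ⊥-elim (q≢r (q≡r _))

  δ-< : ∀ {r q} → r < q → δ r q ≈ 0#
  δ-< r<q = δ-off (ℕₚ.>⇒≢ r<q)

  δ-> : ∀ {r q} → q < r → δ r q ≈ 0#
  δ-> q<r = δ-off (ℕₚ.<⇒≢ q<r)

  sumF-cong : ∀ {N} {f g : Fin N → Carrier} → (∀ a → f a ≈ g a) → sumF f ≈ sumF g
  sumF-cong {zero} f≈g = refl
  sumF-cong {suc N} f≈g = +-cong (f≈g fzero) (sumF-cong (f≈g ∘ fsuc))

  sumF-zero : ∀ {N} {f : Fin N → Carrier} → (∀ a → f a ≈ 0#) → sumF f ≈ 0#
  sumF-zero {zero} f≈0 = refl
  sumF-zero {suc N} f≈0 = trans (+-cong (f≈0 fzero) (sumF-zero (f≈0 ∘ fsuc))) (+-identityʳ 0#)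

  sumF-single : ∀ {N} {f : Fin N → Carrier} (a : Fin N) → (∀ b → b ≢ a → f b ≈ 0#) → sumF f ≈ f a
  sumF-single fzero off = trans (+-cong refl (sumF-zero (λ b → off (fsuc b) λ ()))) (+-identityʳ _)
  sumF-single (fsuc a) off =
    trans (+-cong (off fzero λ ()) (sumF-single a (λ b b≢a → off (fsuc b) (b≢a ∘ suc-injective))))
          (+-identityˡ _)

  sumF-+ : ∀ {N} (f g : Fin N → Carrier) → sumF (λ a → f a +ᴿ g a) ≈ sumF f +ᴿ sumF g
  sumF-+ {zero} f g = sym (+-identityʳ 0#)
  sumF-+ {suc N} f g = trans (+-cong refl (sumF-+ (f ∘ fsuc) (g ∘ fsuc))) (interchange _ _ _ _)

  sumF-distribˡ : ∀ {N} x (f : Fin N → Carrier) → x *ᴿ sumF f ≈ sumF (λ a → x *ᴿ f a)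
  sumF-distribˡ {zero} x f = zeroʳ x
  sumF-distribˡ {suc N} x f = trans (distribˡ x _ _) (+-cong refl (sumF-distribˡ x (f ∘ fsuc)))

  sumF-distribʳ : ∀ {N} x (f : Fin N → Carrier) → sumF f *ᴿ x ≈ sumF (λ a → f a *ᴿ x)
  sumF-distribʳ {zero} x f = zeroˡ x
  sumF-distribʳ {suc N} x f = trans (distribʳ x _ _) (+-cong refl (sumF-distribʳ x (f ∘ fsuc)))

  sumF-comm : ∀ {N K} (f : Fin N → Fin K → Carrier) →
              sumF (λ a → sumF (λ b → f a b)) ≈ sumF (λ b → sumF (λ a → f a b))
  sumF-comm {zero} {K} f = sym (sumF-zero {K} (λ b → refl))
  sumF-comm {suc N} f =
    trans (+-cong refl (sumF-comm (f ∘ fsuc))) (sym (sumF-+ (f fzero) (λ b → sumF (λ a → f (fsuc a) b))))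

  matVec-cong : ∀ {N} (A : Mat N) {x y : Vecᴿ N} → x ≈ᵛ y → matVec A x ≈ᵛ matVec A y
  matVec-cong A x≈y a = sumF-cong (λ b → *-cong refl (x≈y b))

  matVec-zeroʳ : ∀ {N} (A : Mat N) {x : Vecᴿ N} → x ≈ᵛ 0ᵛ → matVec A x ≈ᵛ 0ᵛ
  matVec-zeroʳ A x≈0 a = sumF-zero (λ b → trans (*-cong refl (x≈0 b)) (zeroʳ _))

  matVec-matMul : ∀ {N} (A C : Mat N) (x : Vecᴿ N) → matVec (matMul A C) x ≈ᵛ matVec A (matVec C x)
  matVec-matMul A C x a = begin
    sumF (λ b → sumF (λ d → A a d *ᴿ C d b) *ᴿ x b)    ≈⟨ sumF-cong (λ b → sumF-distribʳ (x b) (λ d → A a d *ᴿ C d b)) ⟩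
    sumF (λ b → sumF (λ d → (A a d *ᴿ C d b) *ᴿ x b))  ≈⟨ sumF-comm (λ b d → (A a d *ᴿ C d b) *ᴿ x b) ⟩
    sumF (λ d → sumF (λ b → (A a d *ᴿ C d b) *ᴿ x b))  ≈⟨ sumF-cong (λ d → sumF-cong (λ b → *-assoc (A a d) (C d b) (x b))) ⟩
    sumF (λ d → sumF (λ b → A a d *ᴿ (C d b *ᴿ x b)))  ≈⟨ sumF-cong (λ d → sym (sumF-distribˡ (A a d) (λ b → C d b *ᴿ x b))) ⟩
    sumF (λ d → A a d *ᴿ sumF (λ b → C d b *ᴿ x b))    ∎

  matVec-idM : ∀ {N} (x : Vecᴿ N) → matVec idM x ≈ᵛ x
  matVec-idM x a = begin
    sumF (λ b → δ (suc (toℕ a)) (suc (toℕ b)) *ᴿ x b)  ≈⟨ sumF-single {f = λ b → δ (suc (toℕ a)) (suc (toℕ b)) *ᴿ x b} a off-diagonal ⟩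
    δ (suc (toℕ a)) (suc (toℕ a)) *ᴿ x a               ≈⟨ *-cong (δ-diag (suc (toℕ a))) refl ⟩
    1# *ᴿ x a                                          ≈⟨ *-identityˡ _ ⟩
    x a                                                ∎
    where
    off-diagonal : ∀ b → b ≢ a → δ (suc (toℕ a)) (suc (toℕ b)) *ᴿ x b ≈ 0#
    off-diagonal b b≢a = trans (*-cong (δ-off (b≢a ∘ toℕ-injective ∘ ℕₚ.suc-injective)) refl) (zeroˡ _)

  !-fromℕ< : ∀ {N} (x : Vecᴿ N) p (p<N : p < N) → x ! suc p ≡ x (fromℕ< p<N)
  !-fromℕ< {N} x p p<N with p <? N
  ... | yes _ = ≡.refl
  ... | no p≮N = ⊥-elim (p≮N p<N)

  !-toℕ : ∀ {N} (x : Vecᴿ N) (a : Fin N) → x ! suc (toℕ a) ≡ x a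
  !-toℕ x a = ≡.trans (!-fromℕ< x (toℕ a) (toℕ<n a)) (≡.cong x (fromℕ<-toℕ a _))

  !-cong : ∀ {N} {x y : Vecᴿ N} → x ≈ᵛ y → ∀ p → x ! p ≈ y ! p
  !-cong x≈y zero = refl
  !-cong {N} x≈y (suc p) with p <? N
  ... | yes _ = x≈y _
  ... | no _ = refl

  !-0ᵛ : ∀ {N} p → 0ᵛ {N} ! p ≈ 0#
  !-0ᵛ zero = refl
  !-0ᵛ {N} (suc p) with p <? N
  ... | yes _ = refl
  ... | no _ = refl

  δ-+ : ∀ a r q → δ (a + r) (a + q) ≡ δ r q
  δ-+ zero r q = ≡.refl
  δ-+ (suc a) r q = δ-+ a r q

  τ-↑ʳ : ∀ {k n} (u : Vecᴿ n) j → τ {k} u (k ↑ʳ j) ≡ u j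
  τ-↑ʳ {k} {n} u j rewrite splitAt-↑ʳ k n j = ≡.refl

  τ-low : ∀ {k n} (u : Vecᴿ n) (a : Fin (k + n)) → toℕ a < k → τ {k} u a ≡ 0#
  τ-low {k} u a a<k with splitAt k a in eq
  ... | inj₁ _ = ≡.refl
  ... | inj₂ j = ⊥-elim (ℕₚ.<⇒≱ a<k k≤a)
    where
    k≤a : k ≤ toℕ a
    k≤a = subst (λ b → k ≤ toℕ b) (splitAt⁻¹-↑ʳ eq) (subst (k ≤_) (≡.sym (toℕ-↑ʳ k j)) (ℕₚ.m≤m+n k (toℕ j)))

data Parity : ℕ → Set where
  even : ∀ a → Parity (2 * a)
  odd  : ∀ a → Parity (suc (2 * a))

parity : ∀ p → Parity p
parity zero = even 0
parity (suc p) with parity p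
... | even a = odd a
... | odd a = subst Parity (ℕₚ.*-suc 2 a) (even (suc a))

-- For 2 ≤ q < X, coordinates 2q+1 and 2q+2 of B(x,y) are x_(q+1) y₃ and x_(q+1) y₄: these are the
-- paper's coordinates 2j + S_i and 2j + 1 + S_i with q = j + 2^i.
data Position (X : ℕ) : ℕ → Set where
  pos₁ : Position X 1
  pos₂ : Position X 2
  pos₃ : Position X 3
  pos₄ : Position X 4
  child₃ : ∀ q → 2 ≤ q → q < X → Position X (suc (2 * q))
  child₄ : ∀ q → 2 ≤ q → q < X → Position X (suc (suc (2 * q)))

position : ∀ X p → 1 ≤ p → p ≤ 2 * X → Position X p
position X 1 _ _ = pos₁
position X 2 _ _ = pos₂
position X 3 _ _ = pos₃
position X 4 _ _ = pos₄
position X (suc (suc (suc (suc (suc p))))) _ p≤2X with parity p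
... | even a = subst (Position X) p≡ (child₃ (2 + a) (s≤s (s≤s z≤n)) (ℕₚ.*-cancelˡ-< 2 _ _ (subst (_≤ 2 * X) (≡.sym p≡) p≤2X)))
  where p≡ = cong suc (ℕₚ.*-distribˡ-+ 2 2 a)
... | odd a = subst (Position X) p≡ (child₄ (2 + a) (s≤s (s≤s z≤n)) (ℕₚ.*-cancelˡ-< 2 _ _ (ℕₚ.≤-trans (ℕₚ.n≤1+n _) (subst (_≤ 2 * X) (≡.sym p≡) p≤2X))))
  where p≡ = cong (suc ∘ suc) (ℕₚ.*-distribˡ-+ 2 2 a)

2≤2^ : ∀ L → 2 ≤ 2 ^ suc L
2≤2^ L = ℕₚ.*-monoʳ-≤ 2 (ℕₚ.m^n>0 2 L)

∸-half< : ∀ {q Y} → Y ≤ q → q < 2 * Y → q ∸ Y < Y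
∸-half< {q} {Y} Y≤q q<2Y =
  subst (q ∸ Y <_) (≡.trans (ℕₚ.m+n∸m≡n Y (Y + 0)) (ℕₚ.+-identityʳ Y)) (ℕₚ.∸-monoˡ-< q<2Y Y≤q)

2*≤1+2*⇒≤ : ∀ P a → 2 * P ≤ suc (2 * a) → P ≤ a
2*≤1+2*⇒≤ P a le = ℕₚ.≤-pred (ℕₚ.*-cancelˡ-< 2 P (suc a) (subst (2 * P <_) (≡.sym (ℕₚ.*-suc 2 a)) (s≤s le)))

record LevelSplit (L q : ℕ) : Set where
  constructor split
  field
    level offset : ℕ
    level<L : suc level ≤ L ∸ 1
    offset< : offset < 2 ^ suc level
    q≡ : q ≡ offset + 2 ^ suc level

level-split : ∀ L q → 2 ≤ q → q < 2 ^ L → LevelSplit L q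
level-split zero q 2≤q q<1 = ⊥-elim (ℕₚ.<⇒≱ q<1 (ℕₚ.≤-trans (ℕₚ.n≤1+n 1) 2≤q))
level-split (suc zero) q 2≤q q<2 = ⊥-elim (ℕₚ.<⇒≱ q<2 2≤q)
level-split (suc (suc L)) q 2≤q q<2Y = extend (q <? Y) (level-split (suc L) q 2≤q)
  where
  Y = 2 ^ suc L
  extend : Dec (q < Y) → (q < Y → LevelSplit (suc L) q) → LevelSplit (suc (suc L)) q
  extend (yes q<Y) rec with rec q<Y
  ... | split l o l< o< q≡ = split l o (ℕₚ.m≤n⇒m≤1+n l<) o< q≡
  extend (no q≮Y) _ = split L (q ∸ Y) ℕₚ.≤-refl q∸Y<Y (≡.sym (ℕₚ.m∸n+n≡m Y≤q))
    where
    Y≤q = ℕₚ.≮⇒≥ q≮Y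
    q∸Y<Y = ∸-half< Y≤q q<2Y

module _ where
  open +-*-Solver

  child₃-index : ∀ j P → 2 * j + (2 * P + 1) ≡ suc (2 * (j + P))
  child₃-index = solve 2 (λ j P → con 2 :* j :+ (con 2 :* P :+ con 1) := con 1 :+ con 2 :* (j :+ P)) ≡.refl

  child₄-index : ∀ j P → 2 * j + 1 + (2 * P + 1) ≡ suc (suc (2 * (j + P)))
  child₄-index = solve 2 (λ j P → con 2 :* j :+ con 1 :+ (con 2 :* P :+ con 1) := con 2 :+ con 2 :* (j :+ P)) ≡.refl

  parent-index : ∀ j P → j + (P + 1) ≡ suc (j + P)
  parent-index = solve 2 (λ j P → j :+ (P :+ con 1) := con 1 :+ (j :+ P)) ≡.refl

  3*-next-level : ∀ l → 3 * suc l + 3 ≡ 3 * suc (suc l)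
  3*-next-level = solve 1 (λ l → con 3 :* (con 1 :+ l) :+ con 3 := con 3 :* (con 2 :+ l)) ≡.refl

  1+c*-next : ∀ c r → suc (c * suc r) + c ≡ suc (c * suc (suc r))
  1+c*-next = solve 2 (λ c r → con 1 :+ c :* (con 1 :+ r) :+ c := con 1 :+ c :* (con 2 :+ r)) ≡.refl

3*≢1+3* : ∀ a b → 3 * a ≢ suc (3 * b)
3*≢1+3* zero b ()
3*≢1+3* (suc a) zero eq with ≡.trans (≡.sym (ℕₚ.*-suc 3 a)) eq
... | ()
3*≢1+3* (suc a) (suc b) eq =
  3*≢1+3* a b (ℕₚ.+-cancelˡ-≡ 3 _ _ (≡.trans (≡.sym (ℕₚ.*-suc 3 a)) (≡.trans eq (cong suc (ℕₚ.*-suc 3 b)))))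

module Reachability {c ℓ} (R : CommutativeRing c ℓ) (n m₀ : ℕ)
  (M : Fin (2 ^ suc (suc m₀)) → WithRing.Mat R n)
  (B : WithRing.Vecᴿ R (kOf (suc (suc m₀)) + n) → WithRing.Vecᴿ R (kOf (suc (suc m₀)) + n) →
       WithRing.Vecᴿ R (kOf (suc (suc m₀)) + n))
  (isB : WithRing.IsB R (suc (suc m₀)) n M B) (i : Fin n) where

  open CommutativeRing R renaming (_+_ to _+ᴿ_; _*_ to _*ᴿ_)
  open WithRing R
  open RingVectors R

  m k 2ᵐ : ℕ
  m = suc (suc m₀)
  k = kOf m
  2ᵐ = 2 ^ m

  2ᵐ≤k : 2ᵐ ≤ k
  2ᵐ≤k = ℕₚ.m≤m+n 2ᵐ (2ᵐ + 0)

  4≤2ᵐ : 4 ≤ 2ᵐ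
  4≤2ᵐ = ℕₚ.*-monoʳ-≤ 2 (ℕₚ.*-monoʳ-≤ 2 (ℕₚ.m^n>0 2 m₀))

  ≤4⇒≤k : ∀ {p} → p ≤ 4 → p ≤ k
  ≤4⇒≤k p≤4 = ℕₚ.≤-trans p≤4 (ℕₚ.≤-trans 4≤2ᵐ 2ᵐ≤k)

  -- π(B x y) weighs M_a by y_(a + S_(m−1)), the a-th leaf of the tree.
  leaf : Fin 2ᵐ → ℕ
  leaf a = toℕ a + S (m ∸ 1)

  leaf≡ : ∀ a → leaf a ≡ suc (toℕ a + 2ᵐ)
  leaf≡ a = parent-index (toℕ a) 2ᵐ

  2ᵐ<leaf : ∀ a → 2ᵐ < leaf a
  2ᵐ<leaf a = subst (2ᵐ <_) (≡.sym (leaf≡ a)) (s≤s (ℕₚ.m≤n+m 2ᵐ (toℕ a)))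

  leaf≤k : ∀ a → leaf a ≤ k
  leaf≤k a = subst (_≤ k) (≡.sym (leaf≡ a)) (subst (suc (toℕ a + 2ᵐ) ≤_) (cong (2ᵐ +_) (≡.sym (ℕₚ.+-identityʳ 2ᵐ))) (ℕₚ.+-monoˡ-≤ 2ᵐ (toℕ<n a)))

  record Coords (D : ℕ → Carrier) (u : Vecᴿ n) (z : Vecᴿ (k + n)) : Set ℓ where
    constructor coords
    field
      head : ∀ p → 1 ≤ p → p ≤ k → z ! p ≈ D p
      tail : π {k} z ≈ᵛ u
  open Coords

  0ʰ : ℕ → Carrier
  0ʰ _ = 0#

  Coords-unique : ∀ {D u x y} → Coords D u x → Coords D u y → x ≈ᵛ y
  Coords-unique {x = x} {y} cx cy a with splitAt k a in eq
  ... | inj₁ b = begin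
    x a              ≡⟨ !-toℕ x a ⟨
    x ! suc (toℕ a)  ≈⟨ head cx _ (s≤s z≤n) a<k ⟩
    _                ≈⟨ head cy _ (s≤s z≤n) a<k ⟨
    y ! suc (toℕ a)  ≡⟨ !-toℕ y a ⟩
    y a              ∎
    where
    open import Relation.Binary.Reasoning.Setoid setoid
    a<k : suc (toℕ a) ≤ k
    a<k = subst (λ a → toℕ a < k) (splitAt⁻¹-↑ˡ eq) (subst (_< k) (≡.sym (toℕ-↑ˡ b n)) (toℕ<n b))
  ... | inj₂ j = subst (λ a → x a ≈ y a) (splitAt⁻¹-↑ʳ eq) (trans (tail cx j) (sym (tail cy j)))

  Coords-tail : ∀ {D u u' z} → u ≈ᵛ u' → Coords D u z → Coords D u' z
  Coords-tail u≈u' (coords hd tl) = coords hd (λ j → trans (tl j) (u≈u' j))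

  Coords-≈ : ∀ {D u x y} → x ≈ᵛ y → Coords D u x → Coords D u y
  Coords-≈ x≈y (coords hd tl) = coords (λ p 1≤p p≤k → trans (sym (!-cong x≈y p)) (hd p 1≤p p≤k)) (λ j → trans (sym (x≈y _)) (tl j))

  Coords-0ᵛ : Coords 0ʰ 0ᵛ 0ᵛ
  Coords-0ᵛ = coords (λ p _ _ → !-0ᵛ p) (λ _ → refl)

  Coords-τ : ∀ u → Coords 0ʰ u (τ {k} u)
  Coords-τ u = coords low (λ j → reflexive (τ-↑ʳ {k} u j))
    where
    low : ∀ p → 1 ≤ p → p ≤ k → τ {k} u ! p ≈ 0#
    low (suc p) _ p<k = reflexive (≡.trans (!-fromℕ< (τ {k} u) p p<k+n) (τ-low {k} u _ (subst (_< k) (≡.sym (toℕ-fromℕ< p<k+n)) p<k)))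
      where p<k+n = ℕₚ.≤-trans p<k (ℕₚ.m≤m+n k n)

  v₀ : Vecᴿ (k + n)
  v₀ = start m n i

  Coords-start : Coords (δ 1) (e′ i) v₀
  Coords-start = coords low high
    where
    low : ∀ p → 1 ≤ p → p ≤ k → v₀ ! p ≈ δ 1 p
    low (suc p) _ p<k = begin
      v₀ ! suc p                                        ≡⟨ !-fromℕ< v₀ p p<k+n ⟩
      δ 1 (suc p') +ᴿ δ (k + suc (toℕ i)) (suc p')      ≡⟨ cong (λ q → δ 1 (suc q) +ᴿ δ (k + suc (toℕ i)) (suc q)) (toℕ-fromℕ< p<k+n) ⟩
      δ 1 (suc p) +ᴿ δ (k + suc (toℕ i)) (suc p)        ≈⟨ +-cong refl (δ-> (ℕₚ.≤-<-trans p<k (ℕₚ.m<m+n k (s≤s z≤n)))) ⟩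
      δ 1 (suc p) +ᴿ 0#                                 ≈⟨ +-identityʳ _ ⟩
      δ 1 (suc p)                                       ∎
      where
      open import Relation.Binary.Reasoning.Setoid setoid
      p<k+n = ℕₚ.≤-trans p<k (ℕₚ.m≤m+n k n)
      p' = toℕ (fromℕ< p<k+n)
    high : ∀ j → π {k} v₀ j ≈ e′ i j
    high j = begin
      δ 1 (suc (toℕ (k ↑ʳ j))) +ᴿ δ (k + suc (toℕ i)) (suc (toℕ (k ↑ʳ j)))
        ≡⟨ cong (λ q → δ 1 (suc q) +ᴿ δ (k + suc (toℕ i)) (suc q)) (toℕ-↑ʳ k j) ⟩
      δ 1 (suc (k + toℕ j)) +ᴿ δ (k + suc (toℕ i)) (suc (k + toℕ j))
        ≡⟨ cong (λ q → δ 1 (suc (k + toℕ j)) +ᴿ δ (k + suc (toℕ i)) q) (≡.sym (ℕₚ.+-suc k (toℕ j))) ⟩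
      δ 1 (suc (k + toℕ j)) +ᴿ δ (k + suc (toℕ i)) (k + suc (toℕ j))
        ≈⟨ +-cong (δ-< (s≤s (ℕₚ.≤-trans (≤4⇒≤k (s≤s z≤n)) (ℕₚ.m≤m+n k (toℕ j))))) (reflexive (δ-+ k _ _)) ⟩
      0# +ᴿ e′ i j
        ≈⟨ +-identityˡ _ ⟩
      e′ i j ∎
      where open import Relation.Binary.Reasoning.Setoid setoid

  head-small : ∀ {D u z} → Coords D u z → ∀ p {1≤p : True (1 ≤? p)} {p≤4 : True (p ≤? 4)} → z ! p ≈ D p
  head-small cz p {1≤p} {p≤4} = head cz p (toWitness 1≤p) (≤4⇒≤k (toWitness p≤4))

  B-child₃ : ∀ x y q → 2 ≤ q → q < 2ᵐ → B x y ! suc (2 * q) ≈ (x ! suc q) *ᴿ (y ! 3)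
  B-child₃ x y q 2≤q q<2ᵐ with isB x y | level-split m q 2≤q q<2ᵐ
  ... | _ , _ , _ , _ , Bᵢⱼ , _ | split l j l< j< ≡.refl =
    subst₂ (λ a b → B x y ! a ≈ (x ! b) *ᴿ (y ! 3)) (child₃-index j (2 ^ suc l)) (parent-index j (2 ^ suc l))
      (proj₁ (Bᵢⱼ (suc l) j (s≤s z≤n) l< j<))

  B-child₄ : ∀ x y q → 2 ≤ q → q < 2ᵐ → B x y ! suc (suc (2 * q)) ≈ (x ! suc q) *ᴿ (y ! 4)
  B-child₄ x y q 2≤q q<2ᵐ with isB x y | level-split m q 2≤q q<2ᵐ
  ... | _ , _ , _ , _ , Bᵢⱼ , _ | split l j l< j< ≡.refl =
    subst₂ (λ a b → B x y ! a ≈ (x ! b) *ᴿ (y ! 4)) (child₄-index j (2 ^ suc l)) (parent-index j (2 ^ suc l))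
      (proj₂ (Bᵢⱼ (suc l) j (s≤s z≤n) l< j<))

  B-coords : ∀ {D u D' u' x y} → Coords D u x → Coords D' u' y → (D'' : ℕ → Carrier) (u'' : Vecᴿ n) →
    D'' 1 ≈ 0# → D'' 2 ≈ D 1 *ᴿ D' 1 → D'' 3 ≈ D 1 *ᴿ D' 2 → D'' 4 ≈ D 2 *ᴿ D' 1 →
    (∀ q → 2 ≤ q → q < 2ᵐ → D'' (suc (2 * q)) ≈ D (suc q) *ᴿ D' 3) →
    (∀ q → 2 ≤ q → q < 2ᵐ → D'' (suc (suc (2 * q))) ≈ D (suc q) *ᴿ D' 4) →
    (u'' ≈ᵛ λ j → sumF (λ a → D' (leaf a) *ᴿ matVec (M a) u j)) →
    Coords D'' u'' (B x y)
  B-coords {D} {u} {D'} {u'} {x} {y} cx cy D'' u'' at₁ at₂ at₃ at₄ at-child₃ at-child₄ at-tail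
    with isB x y
  ... | B₁ , B₂ , B₃ , B₄ , _ , Bπ = coords hd tl
    where
    parent : ∀ q → q < 2ᵐ → x ! suc q ≈ D (suc q)
    parent q q<2ᵐ = head cx (suc q) (s≤s z≤n) (ℕₚ.≤-trans q<2ᵐ 2ᵐ≤k)
    hd : ∀ p → 1 ≤ p → p ≤ k → B x y ! p ≈ D'' p
    hd p 1≤p p≤k with position 2ᵐ p 1≤p p≤k
    ... | pos₁ = trans B₁ (sym at₁)
    ... | pos₂ = trans B₂ (trans (*-cong (head-small cx 1) (head-small cy 1)) (sym at₂))
    ... | pos₃ = trans B₃ (trans (*-cong (head-small cx 1) (head-small cy 2)) (sym at₃))
    ... | pos₄ = trans B₄ (trans (*-cong (head-small cx 2) (head-small cy 1)) (sym at₄))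
    ... | child₃ q 2≤q q<2ᵐ =
      trans (B-child₃ x y q 2≤q q<2ᵐ) (trans (*-cong (parent q q<2ᵐ) (head-small cy 3)) (sym (at-child₃ q 2≤q q<2ᵐ)))
    ... | child₄ q 2≤q q<2ᵐ =
      trans (B-child₄ x y q 2≤q q<2ᵐ) (trans (*-cong (parent q q<2ᵐ) (head-small cy 4)) (sym (at-child₄ q 2≤q q<2ᵐ)))
    tl : π {k} (B x y) ≈ᵛ u''
    tl j = trans (Bπ j) (trans (sumF-cong (λ a → *-cong (head cy (leaf a) (ℕₚ.≤-trans (s≤s z≤n) (2ᵐ<leaf a)) (leaf≤k a)) (matVec-cong (M a) (tail cx) j)))
                               (sym (at-tail j)))

  leaf-sum-zero : ∀ s u → s ≤ 2ᵐ → (λ j → sumF (λ a → δ s (leaf a) *ᴿ matVec (M a) u j)) ≈ᵛ 0ᵛ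
  leaf-sum-zero s u s≤2ᵐ j = sumF-zero (λ a → trans (*-cong (δ-< (ℕₚ.≤-<-trans s≤2ᵐ (2ᵐ<leaf a))) refl) (zeroˡ _))

  B-zeroʳ : ∀ {D u u' x y} → Coords D u x → Coords 0ʰ u' y → Coords 0ʰ 0ᵛ (B x y)
  B-zeroʳ {u = u} cx cy = B-coords cx cy 0ʰ 0ᵛ refl (z* _) (z* _) (z* _) (λ _ _ _ → z* _) (λ _ _ _ → z* _)
    (λ j → sym (sumF-zero (λ a → zeroˡ (matVec (M a) u j))))
    where z* = λ a → sym (zeroʳ a)

  B-zeroˡ : ∀ {D' u' x y} → Coords 0ʰ 0ᵛ x → Coords D' u' y → Coords 0ʰ 0ᵛ (B x y)
  B-zeroˡ cx cy = B-coords cx cy 0ʰ 0ᵛ refl (z* _) (z* _) (z* _) (λ _ _ _ → z* _) (λ _ _ _ → z* _)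
    (λ j → sym (sumF-zero (λ a → trans (*-cong refl (matVec-zeroʳ (M a) (λ _ → refl) j)) (zeroʳ _))))
    where z* = λ a → sym (zeroˡ a)

  private
    ≈-*1 : ∀ {a b} → a ≈ b → a ≈ b *ᴿ 1#
    ≈-*1 a≈b = trans a≈b (sym (*-identityʳ _))

    ≈-*0 : ∀ {a b} → a ≈ 0# → a ≈ b *ᴿ 0#
    ≈-*0 a≈0 = trans a≈0 (sym (zeroʳ _))

  B-by-e₁ : ∀ {D u u' x y} → Coords D u x → Coords (δ 1) u' y → (D'' : ℕ → Carrier) →
    D'' 1 ≈ 0# → D'' 2 ≈ D 1 → D'' 3 ≈ 0# → D'' 4 ≈ D 2 →
    (∀ q → 2 ≤ q → q < 2ᵐ → D'' (suc (2 * q)) ≈ 0#) → (∀ q → 2 ≤ q → q < 2ᵐ → D'' (suc (suc (2 * q))) ≈ 0#) →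
    Coords D'' 0ᵛ (B x y)
  B-by-e₁ cx cy D'' at₁ at₂ at₃ at₄ at-child₃ at-child₄ =
    B-coords cx cy D'' 0ᵛ at₁ (≈-*1 at₂) (≈-*0 at₃) (≈-*1 at₄)
      (λ q 2≤q q< → ≈-*0 (at-child₃ q 2≤q q<)) (λ q 2≤q q< → ≈-*0 (at-child₄ q 2≤q q<))
      (sym ∘ leaf-sum-zero 1 _ (ℕₚ.≤-trans (s≤s z≤n) 4≤2ᵐ))

  B-by-e₂ : ∀ {D u u' x y} → Coords D u x → Coords (δ 2) u' y → (D'' : ℕ → Carrier) →
    D'' 1 ≈ 0# → D'' 2 ≈ 0# → D'' 3 ≈ D 1 → D'' 4 ≈ 0# →
    (∀ q → 2 ≤ q → q < 2ᵐ → D'' (suc (2 * q)) ≈ 0#) → (∀ q → 2 ≤ q → q < 2ᵐ → D'' (suc (suc (2 * q))) ≈ 0#) →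
    Coords D'' 0ᵛ (B x y)
  B-by-e₂ cx cy D'' at₁ at₂ at₃ at₄ at-child₃ at-child₄ =
    B-coords cx cy D'' 0ᵛ at₁ (≈-*0 at₂) (≈-*1 at₃) (≈-*0 at₄)
      (λ q 2≤q q< → ≈-*0 (at-child₃ q 2≤q q<)) (λ q 2≤q q< → ≈-*0 (at-child₄ q 2≤q q<))
      (sym ∘ leaf-sum-zero 2 _ (ℕₚ.≤-trans (s≤s (s≤s z≤n)) 4≤2ᵐ))

  B-by-e₃ : ∀ {D u u' x y} → Coords D u x → Coords (δ 3) u' y → (D'' : ℕ → Carrier) →
    D'' 1 ≈ 0# → D'' 2 ≈ 0# → D'' 3 ≈ 0# → D'' 4 ≈ 0# →
    (∀ q → 2 ≤ q → q < 2ᵐ → D'' (suc (2 * q)) ≈ D (suc q)) → (∀ q → 2 ≤ q → q < 2ᵐ → D'' (suc (suc (2 * q))) ≈ 0#) →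
    Coords D'' 0ᵛ (B x y)
  B-by-e₃ cx cy D'' at₁ at₂ at₃ at₄ at-child₃ at-child₄ =
    B-coords cx cy D'' 0ᵛ at₁ (≈-*0 at₂) (≈-*0 at₃) (≈-*0 at₄)
      (λ q 2≤q q< → ≈-*1 (at-child₃ q 2≤q q<)) (λ q 2≤q q< → ≈-*0 (at-child₄ q 2≤q q<))
      (sym ∘ leaf-sum-zero 3 _ (ℕₚ.≤-trans (s≤s (s≤s (s≤s z≤n))) 4≤2ᵐ))

  B-by-e₄ : ∀ {D u u' x y} → Coords D u x → Coords (δ 4) u' y → (D'' : ℕ → Carrier) →
    D'' 1 ≈ 0# → D'' 2 ≈ 0# → D'' 3 ≈ 0# → D'' 4 ≈ 0# →
    (∀ q → 2 ≤ q → q < 2ᵐ → D'' (suc (2 * q)) ≈ 0#) → (∀ q → 2 ≤ q → q < 2ᵐ → D'' (suc (suc (2 * q))) ≈ D (suc q)) →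
    Coords D'' 0ᵛ (B x y)
  B-by-e₄ cx cy D'' at₁ at₂ at₃ at₄ at-child₃ at-child₄ =
    B-coords cx cy D'' 0ᵛ at₁ (≈-*0 at₂) (≈-*0 at₃) (≈-*0 at₄)
      (λ q 2≤q q< → ≈-*0 (at-child₃ q 2≤q q<)) (λ q 2≤q q< → ≈-*1 (at-child₄ q 2≤q q<))
      (sym ∘ leaf-sum-zero 4 _ 4≤2ᵐ)

  leaf-injective : ∀ {a b} → leaf a ≡ leaf b → a ≡ b
  leaf-injective {a} {b} eq = toℕ-injective (ℕₚ.+-cancelʳ-≡ (S (m ∸ 1)) (toℕ a) (toℕ b) eq)

  private
    δ-small : ∀ {r} t → 5 ≤ r → t ≤ 4 → δ r t ≈ 0#
    δ-small t 5≤r t≤4 = δ-> (ℕₚ.≤-trans (s≤s t≤4) 5≤r)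

    0≈*δ-small : ∀ {r t} b → 5 ≤ r → t ≤ 4 → 0# ≈ b *ᴿ δ r t
    0≈*δ-small {t = t} b 5≤r t≤4 = sym (trans (*-cong refl (δ-small t 5≤r t≤4)) (zeroʳ b))

    5≤1+2* : ∀ q → 2 ≤ q → 5 ≤ suc (2 * q)
    5≤1+2* q 2≤q = s≤s (ℕₚ.*-monoʳ-≤ 2 2≤q)

  B-by-inner : ∀ {D u u' x y} q → Coords D u x → Coords (δ q) u' y → 5 ≤ q → q ≤ 2ᵐ → Coords 0ʰ 0ᵛ (B x y)
  B-by-inner q cx cy 5≤q q≤2ᵐ =
    B-coords cx cy 0ʰ 0ᵛ refl (low 1) (low 2) (low 1) (λ _ _ _ → low 3) (λ _ _ _ → low 4)
      (sym ∘ leaf-sum-zero q _ q≤2ᵐ)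
    where
    low : ∀ {b} t {t≤4 : True (t ≤? 4)} → 0# ≈ b *ᴿ δ q t
    low t {t≤4} = 0≈*δ-small _ 5≤q (toWitness t≤4)

  B-by-leaf : ∀ {D u u' x y} (a : Fin 2ᵐ) → Coords D u x → Coords (δ (leaf a)) u' y → Coords 0ʰ (matVec (M a) u) (B x y)
  B-by-leaf {u = u} a cx cy =
    B-coords cx cy 0ʰ (matVec (M a) u) refl (low 1) (low 2) (low 1) (λ _ _ _ → low 3) (λ _ _ _ → low 4) pick-a
    where
    5≤leaf = ℕₚ.≤-trans (s≤s 4≤2ᵐ) (2ᵐ<leaf a)
    low : ∀ {b} t {t≤4 : True (t ≤? 4)} → 0# ≈ b *ᴿ δ (leaf a) t
    low t {t≤4} = 0≈*δ-small _ 5≤leaf (toWitness t≤4)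
    pick-a : matVec (M a) u ≈ᵛ λ j → sumF (λ b → δ (leaf a) (leaf b) *ᴿ matVec (M b) u j)
    pick-a j = sym (trans (sumF-single a (λ b b≢a → trans (*-cong (δ-off (b≢a ∘ leaf-injective)) refl) (zeroˡ _)))
                          (trans (*-cong (δ-diag (leaf a)) refl) (*-identityˡ _)))

  B-node-e₃ : ∀ {u u' x y} a → 2 ≤ a → Coords (δ (suc a)) u x → Coords (δ 3) u' y →
              Coords (δ (suc (2 * a))) 0ᵛ (B x y)
  B-node-e₃ a 2≤a cx cy =
    B-by-e₃ cx cy (δ (suc (2 * a))) (low 1) (low 2) (low 3) (low 4) same-child other-child
    where
    low : ∀ t {t≤4 : True (t ≤? 4)} → δ (suc (2 * a)) t ≈ 0#
    low t {t≤4} = δ-small t (5≤1+2* a 2≤a) (toWitness t≤4)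
    same-child : ∀ q → 2 ≤ q → q < 2ᵐ → δ (suc (2 * a)) (suc (2 * q)) ≈ δ (suc a) (suc q)
    same-child q _ _ with q ≟ a
    ... | yes ≡.refl = trans (δ-diag (suc (2 * q))) (sym (δ-diag (suc q)))
    ... | no q≢a = trans (δ-off (q≢a ∘ ℕₚ.*-cancelˡ-≡ q a 2 ∘ ℕₚ.suc-injective)) (sym (δ-off (q≢a ∘ ℕₚ.suc-injective)))
    other-child : ∀ q → 2 ≤ q → q < 2ᵐ → δ (suc (2 * a)) (suc (suc (2 * q))) ≈ 0#
    other-child q _ _ = δ-off (ℕₚ.even≢odd a q ∘ ≡.sym ∘ ℕₚ.suc-injective)

  B-node-e₄ : ∀ {u u' x y} a → 2 ≤ a → Coords (δ (suc a)) u x → Coords (δ 4) u' y →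
              Coords (δ (suc (suc (2 * a)))) 0ᵛ (B x y)
  B-node-e₄ a 2≤a cx cy =
    B-by-e₄ cx cy (δ (suc (suc (2 * a)))) (low 1) (low 2) (low 3) (low 4) other-child same-child
    where
    low : ∀ t {t≤4 : True (t ≤? 4)} → δ (suc (suc (2 * a))) t ≈ 0#
    low t {t≤4} = δ-small t (ℕₚ.≤-trans (5≤1+2* a 2≤a) (ℕₚ.n≤1+n _)) (toWitness t≤4)
    same-child : ∀ q → 2 ≤ q → q < 2ᵐ → δ (suc (suc (2 * a))) (suc (suc (2 * q))) ≈ δ (suc a) (suc q)
    same-child q _ _ with q ≟ a
    ... | yes ≡.refl = trans (δ-diag (suc (suc (2 * q)))) (sym (δ-diag (suc q)))
    ... | no q≢a = trans (δ-off (q≢a ∘ ℕₚ.*-cancelˡ-≡ q a 2 ∘ ℕₚ.suc-injective ∘ ℕₚ.suc-injective))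
                         (sym (δ-off (q≢a ∘ ℕₚ.suc-injective)))
    other-child : ∀ q → 2 ≤ q → q < 2ᵐ → δ (suc (suc (2 * a))) (suc (2 * q)) ≈ 0#
    other-child q _ _ = δ-off (ℕₚ.even≢odd q a ∘ ℕₚ.suc-injective)

  B-by-e₃-vanishing : ∀ {D u u' x y} → Coords D u x → Coords (δ 3) u' y →
                      (∀ q → 2 ≤ q → q < 2ᵐ → 0# ≈ D (suc q)) → Coords 0ʰ 0ᵛ (B x y)
  B-by-e₃-vanishing cx cy D≈0 = B-by-e₃ cx cy 0ʰ refl refl refl refl D≈0 (λ _ _ _ → refl)

  B-by-e₄-vanishing : ∀ {D u u' x y} → Coords D u x → Coords (δ 4) u' y →
                      (∀ q → 2 ≤ q → q < 2ᵐ → 0# ≈ D (suc q)) → Coords 0ʰ 0ᵛ (B x y)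
  B-by-e₄-vanishing cx cy D≈0 = B-by-e₄ cx cy 0ʰ refl refl refl refl (λ _ _ _ → refl) D≈0

  Coords-self : ∀ z → Coords (z !_) (π {k} z) z
  Coords-self z = coords (λ _ _ _ → refl) (λ _ → refl)

  δ-small-child₃ : ∀ r {r≤4 : True (r ≤? 4)} q → 2 ≤ q → q < 2ᵐ → δ r (suc (2 * q)) ≈ 0#
  δ-small-child₃ r {r≤4} q 2≤q _ = δ-< (ℕₚ.≤-trans (s≤s (toWitness r≤4)) (5≤1+2* q 2≤q))

  δ-small-child₄ : ∀ r {r≤4 : True (r ≤? 4)} q → 2 ≤ q → q < 2ᵐ → δ r (suc (suc (2 * q))) ≈ 0#
  δ-small-child₄ r {r≤4} q 2≤q _ = δ-< (ℕₚ.≤-trans (s≤s (toWitness r≤4)) (ℕₚ.≤-trans (5≤1+2* q 2≤q) (ℕₚ.n≤1+n _)))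

  data Shape : ℕ → Vecᴿ (k + n) → Set (c ⊔ ℓ) where
    vanishing : ∀ {t z} → Coords 0ʰ 0ᵛ z → Shape t z
    root : ∀ {z} → Coords (δ 1) (e′ i) z → Shape 1 z
    e₂ : ∀ {z} → Coords (δ 2) 0ᵛ z → Shape 2 z
    node : ∀ {t z} l p → suc l ≤ m → 2 ^ suc l < p → p ≤ 2 ^ suc (suc l) → t ≡ 3 * suc l →
           Coords (δ p) 0ᵛ z → Shape t z
    word : ∀ {t z} r (w : Vec (Fin 2ᵐ) (suc r)) → t ≡ suc (3 * m * suc r) →
           Coords 0ʰ (matVec (wordProd M w) (e′ i)) z → Shape t z

  data NodeKind (l p : ℕ) : Set where
    e₃-node : l ≡ 0 → p ≡ 3 → NodeKind l p
    e₄-node : l ≡ 0 → p ≡ 4 → NodeKind l p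
    leaf-node : (a : Fin 2ᵐ) → suc l ≡ m → p ≡ leaf a → NodeKind l p
    inner-node : 5 ≤ p → p ≤ 2ᵐ → NodeKind l p

  nodeKind : ∀ l p → suc l ≤ m → 2 ^ suc l < p → p ≤ 2 ^ suc (suc l) → NodeKind l p
  nodeKind zero 0 _ () _
  nodeKind zero 1 _ (s≤s ()) _
  nodeKind zero 2 _ (s≤s (s≤s ())) _
  nodeKind zero 3 _ _ _ = e₃-node ≡.refl ≡.refl
  nodeKind zero 4 _ _ _ = e₄-node ≡.refl ≡.refl
  nodeKind zero (suc (suc (suc (suc (suc _))))) _ _ (s≤s (s≤s (s≤s (s≤s ()))))
  nodeKind (suc l) zero _ () _
  nodeKind (suc l) (suc p) l<m lb ub with suc (suc l) ≟ m
  ... | yes ≡.refl = leaf-node (fromℕ< p∸2ᵐ<2ᵐ) ≡.refl (≡.sym p≡)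
    where
    2ᵐ≤p = ℕₚ.≤-pred lb
    p∸2ᵐ<2ᵐ = ∸-half< 2ᵐ≤p ub
    p≡ : leaf (fromℕ< p∸2ᵐ<2ᵐ) ≡ suc p
    p≡ = ≡.trans (cong (_+ S (m ∸ 1)) (toℕ-fromℕ< p∸2ᵐ<2ᵐ))
                 (≡.trans (parent-index (p ∸ 2ᵐ) 2ᵐ) (cong suc (ℕₚ.m∸n+n≡m 2ᵐ≤p)))
  ... | no l+2≢m = inner-node (ℕₚ.≤-trans (s≤s (ℕₚ.^-monoʳ-≤ 2 {2} {suc (suc l)} (s≤s (s≤s z≤n)))) lb)
                              (ℕₚ.≤-trans ub (ℕₚ.^-monoʳ-≤ 2 (ℕₚ.≤∧≢⇒< l<m l+2≢m)))

  private
    δ₁-above-2 : ∀ q → 2 ≤ q → q < 2ᵐ → 0# ≈ δ 1 (suc q)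
    δ₁-above-2 q 2≤q _ = sym (δ-< (s≤s (ℕₚ.≤-trans (s≤s z≤n) 2≤q)))

    δ₂-above-2 : ∀ q → 2 ≤ q → q < 2ᵐ → 0# ≈ δ 2 (suc q)
    δ₂-above-2 q 2≤q _ = sym (δ-< (s≤s 2≤q))

    δ-leaf-childless : ∀ l a → suc l ≡ m → 2 ^ suc l < suc a → ∀ q → 2 ≤ q → q < 2ᵐ → 0# ≈ δ (suc a) (suc q)
    δ-leaf-childless l a ≡.refl lb q _ q<2ᵐ = sym (δ-> (s≤s (ℕₚ.<-≤-trans q<2ᵐ (ℕₚ.≤-pred lb))))

  Shape-B-e₃ : ∀ {t₁ t₂ x y} → Shape t₁ x → t₂ ≡ 3 → Coords (δ 3) 0ᵛ y → Shape (t₁ + t₂) (B x y)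
  Shape-B-e₃ (vanishing cx) _ cy = vanishing (B-zeroˡ cx cy)
  Shape-B-e₃ (root cx) _ cy = vanishing (B-by-e₃-vanishing cx cy δ₁-above-2)
  Shape-B-e₃ (e₂ cx) _ cy = vanishing (B-by-e₃-vanishing cx cy δ₂-above-2)
  Shape-B-e₃ (node l zero _ () _ _ _) _ _
  Shape-B-e₃ (node l (suc a) l<m lb ub t₁≡ cx) t₂≡ cy with suc (suc l) ≤? m
  ... | yes l+1<m = node (suc l) (suc (2 * a)) l+1<m (s≤s (ℕₚ.*-monoʳ-≤ 2 (ℕₚ.≤-pred lb)))
          (ℕₚ.≤-trans (ℕₚ.n≤1+n _) (ℕₚ.≤-trans (ℕₚ.≤-reflexive (≡.sym (ℕₚ.*-suc 2 a))) (ℕₚ.*-monoʳ-≤ 2 ub)))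
          (≡.trans (cong₂ _+_ t₁≡ t₂≡) (3*-next-level l))
          (B-node-e₃ a (ℕₚ.≤-trans (2≤2^ l) (ℕₚ.≤-pred lb)) cx cy)
  ... | no l+1≮m = vanishing (B-by-e₃-vanishing cx cy (δ-leaf-childless l a (ℕₚ.≤-antisym l<m (ℕₚ.≮⇒≥ l+1≮m)) lb))
  Shape-B-e₃ (word _ _ _ cx) _ cy = vanishing (B-by-e₃-vanishing cx cy (λ _ _ _ → refl))

  Shape-B-e₄ : ∀ {t₁ t₂ x y} → Shape t₁ x → t₂ ≡ 3 → Coords (δ 4) 0ᵛ y → Shape (t₁ + t₂) (B x y)
  Shape-B-e₄ (vanishing cx) _ cy = vanishing (B-zeroˡ cx cy)
  Shape-B-e₄ (root cx) _ cy = vanishing (B-by-e₄-vanishing cx cy δ₁-above-2)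
  Shape-B-e₄ (e₂ cx) _ cy = vanishing (B-by-e₄-vanishing cx cy δ₂-above-2)
  Shape-B-e₄ (node l zero _ () _ _ _) _ _
  Shape-B-e₄ (node l (suc a) l<m lb ub t₁≡ cx) t₂≡ cy with suc (suc l) ≤? m
  ... | yes l+1<m = node (suc l) (suc (suc (2 * a))) l+1<m
          (ℕₚ.≤-trans (s≤s (ℕₚ.*-monoʳ-≤ 2 (ℕₚ.≤-pred lb))) (ℕₚ.n≤1+n _))
          (ℕₚ.≤-trans (ℕₚ.≤-reflexive (≡.sym (ℕₚ.*-suc 2 a))) (ℕₚ.*-monoʳ-≤ 2 ub))
          (≡.trans (cong₂ _+_ t₁≡ t₂≡) (3*-next-level l))
          (B-node-e₄ a (ℕₚ.≤-trans (2≤2^ l) (ℕₚ.≤-pred lb)) cx cy)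
  ... | no l+1≮m = vanishing (B-by-e₄-vanishing cx cy (δ-leaf-childless l a (ℕₚ.≤-antisym l<m (ℕₚ.≮⇒≥ l+1≮m)) lb))
  Shape-B-e₄ (word _ _ _ cx) _ cy = vanishing (B-by-e₄-vanishing cx cy (λ _ _ _ → refl))

  one-letter-word : ∀ a → matVec (M a) (e′ i) ≈ᵛ matVec (wordProd M (a ∷ [])) (e′ i)
  one-letter-word a j = sym (trans (matVec-matMul (M a) idM (e′ i) j) (matVec-cong (M a) (matVec-idM (e′ i)) j))

  Shape-B-leaf : ∀ {t₁ t₂ x y} → Shape t₁ x → (a : Fin 2ᵐ) → t₂ ≡ 3 * m → Coords (δ (leaf a)) 0ᵛ y →
                 Shape (t₁ + t₂) (B x y)
  Shape-B-leaf (vanishing cx) a _ cy = vanishing (B-zeroˡ cx cy)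
  Shape-B-leaf (root cx) a t₂≡ cy =
    word 0 (a ∷ []) (cong suc (≡.trans t₂≡ (≡.sym (ℕₚ.*-identityʳ (3 * m)))))
      (Coords-tail (one-letter-word a)
                   (B-by-leaf a cx cy))
  Shape-B-leaf (e₂ cx) a _ cy = vanishing (Coords-tail (matVec-zeroʳ (M a) (λ _ → refl)) (B-by-leaf a cx cy))
  Shape-B-leaf (node _ _ _ _ _ _ cx) a _ cy = vanishing (Coords-tail (matVec-zeroʳ (M a) (λ _ → refl)) (B-by-leaf a cx cy))
  Shape-B-leaf (word r w t₁≡ cx) a t₂≡ cy =
    word (suc r) (a ∷ w) (≡.trans (cong₂ _+_ t₁≡ t₂≡) (1+c*-next (3 * m) r))
      (Coords-tail (λ j → sym (matVec-matMul (M a) (wordProd M w) (e′ i) j)) (B-by-leaf a cx cy))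

  Shape-B : ∀ {t₁ t₂ x y} → Shape t₁ x → Shape t₂ y → Shape (t₁ + t₂) (B x y)
  Shape-B {x = x} _ (vanishing cy) = vanishing (B-zeroʳ (Coords-self x) cy)
  Shape-B {x = x} _ (word _ _ _ cy) = vanishing (B-zeroʳ (Coords-self x) cy)
  Shape-B {y = y} (vanishing cx) _ = vanishing (B-zeroˡ cx (Coords-self y))
  Shape-B (root cx) (root cy) =
    e₂ (B-by-e₁ cx cy (δ 2) refl refl refl refl (δ-small-child₃ 2) (δ-small-child₄ 2))
  Shape-B (e₂ cx) (root cy) =
    node 0 4 (s≤s z≤n) (ℕₚ.n≤1+n 3) ℕₚ.≤-refl ≡.refl
      (B-by-e₁ cx cy (δ 4) refl refl refl refl (δ-small-child₃ 4) (δ-small-child₄ 4))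
  Shape-B (node l p _ lb _ _ cx) (root cy) =
    vanishing (B-by-e₁ cx cy 0ʰ refl (sym (δ-> (ℕₚ.≤-trans (s≤s (ℕₚ.n≤1+n 1)) 3≤p))) refl (sym (δ-> 3≤p))
                                (λ _ _ _ → refl) (λ _ _ _ → refl))
    where 3≤p = ℕₚ.≤-trans (s≤s (2≤2^ l)) lb
  Shape-B (word _ _ _ cx) (root cy) = vanishing (B-by-e₁ cx cy 0ʰ refl refl refl refl (λ _ _ _ → refl) (λ _ _ _ → refl))
  Shape-B (root cx) (e₂ cy) =
    node 0 3 (s≤s z≤n) ℕₚ.≤-refl (ℕₚ.n≤1+n 3) ≡.refl
      (B-by-e₂ cx cy (δ 3) refl refl refl refl (δ-small-child₃ 3) (δ-small-child₄ 3))
  Shape-B (e₂ cx) (e₂ cy) = vanishing (B-by-e₂ cx cy 0ʰ refl refl refl refl (λ _ _ _ → refl) (λ _ _ _ → refl))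
  Shape-B (node l p _ lb _ _ cx) (e₂ cy) =
    vanishing (B-by-e₂ cx cy 0ʰ refl refl (sym (δ-> (ℕₚ.≤-trans (s≤s (ℕₚ.n≤1+n 1)) 3≤p))) refl
                                (λ _ _ _ → refl) (λ _ _ _ → refl))
    where 3≤p = ℕₚ.≤-trans (s≤s (2≤2^ l)) lb
  Shape-B (word _ _ _ cx) (e₂ cy) = vanishing (B-by-e₂ cx cy 0ʰ refl refl refl refl (λ _ _ _ → refl) (λ _ _ _ → refl))
  Shape-B sx (node l p l<m lb ub t₂≡ cy) with nodeKind l p l<m lb ub
  ... | e₃-node ≡.refl ≡.refl = Shape-B-e₃ sx t₂≡ cy
  ... | e₄-node ≡.refl ≡.refl = Shape-B-e₄ sx t₂≡ cy
  ... | leaf-node a ≡.refl ≡.refl = Shape-B-leaf sx a t₂≡ cy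
  ... | inner-node 5≤p p≤2ᵐ = vanishing (B-by-inner p (Coords-self _) cy 5≤p p≤2ᵐ)

  shape : ∀ {t z} → InA B v₀ t z → Shape t z
  shape base = root Coords-start
  shape (step x∈A y∈A) = Shape-B (shape x∈A) (shape y∈A)

  Realised : ℕ → (ℕ → Carrier) → Vecᴿ n → Set (c ⊔ ℓ)
  Realised t D u = Σ (Vecᴿ (k + n)) λ z → InA B v₀ t z × Coords D u z

  e₂-realised : Realised 2 (δ 2) 0ᵛ
  e₂-realised = B v₀ v₀ , step base base ,
    B-by-e₁ Coords-start Coords-start (δ 2) refl refl refl refl (δ-small-child₃ 2) (δ-small-child₄ 2)

  e₃-realised : Realised 3 (δ 3) 0ᵛ
  e₃-realised with e₂-realised
  ... | z , z∈A , cz = B v₀ z , step base z∈A ,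
    B-by-e₂ Coords-start cz (δ 3) refl refl refl refl (δ-small-child₃ 3) (δ-small-child₄ 3)

  e₄-realised : Realised 3 (δ 4) 0ᵛ
  e₄-realised with e₂-realised
  ... | z , z∈A , cz = B z v₀ , step z∈A base ,
    B-by-e₁ cz Coords-start (δ 4) refl refl refl refl (δ-small-child₃ 4) (δ-small-child₄ 4)

  zero-realised : ∀ t → 4 ≤ t → Realised t 0ʰ 0ᵛ
  zero-realised 0 ()
  zero-realised 1 (s≤s ())
  zero-realised 2 (s≤s (s≤s ()))
  zero-realised 3 (s≤s (s≤s (s≤s ())))
  zero-realised 4 _ with e₃-realised
  ... | z , z∈A , cz = B v₀ z , step base z∈A , B-by-e₃-vanishing Coords-start cz δ₁-above-2
  zero-realised (suc (suc (suc (suc (suc t))))) _ with zero-realised (4 + t) (s≤s (s≤s (s≤s (s≤s z≤n))))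
  ... | z , z∈A , cz = B z v₀ , subst (λ s → InA B v₀ s (B z v₀)) (ℕₚ.+-comm (4 + t) 1) (step z∈A base) ,
    B-zeroˡ cz Coords-start

  node-realised : ∀ l p → suc l ≤ m → 2 ^ suc l < p → p ≤ 2 ^ suc (suc l) → Realised (3 * suc l) (δ p) 0ᵛ
  node-realised zero 0 _ () _
  node-realised zero 1 _ (s≤s ()) _
  node-realised zero 2 _ (s≤s (s≤s ())) _
  node-realised zero 3 _ _ _ = e₃-realised
  node-realised zero 4 _ _ _ = e₄-realised
  node-realised zero (suc (suc (suc (suc (suc _))))) _ _ (s≤s (s≤s (s≤s (s≤s ()))))
  node-realised (suc l) zero _ () _
  node-realised (suc l) (suc p) l<m lb ub with parity p
  ... | even a with node-realised l (suc a) (ℕₚ.<⇒≤ l<m) (s≤s (ℕₚ.*-cancelˡ-≤ 2 (ℕₚ.≤-pred lb))) (ℕₚ.*-cancelˡ-< 2 a _ ub)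
  ...   | z , z∈A , cz with e₃-realised
  ...     | y , y∈A , cy = B z y , subst (λ s → InA B v₀ s (B z y)) (3*-next-level l) (step z∈A y∈A) ,
                           B-node-e₃ a (ℕₚ.≤-trans (2≤2^ l) (ℕₚ.*-cancelˡ-≤ 2 (ℕₚ.≤-pred lb))) cz cy
  node-realised (suc l) (suc p) l<m lb ub | odd a
    with node-realised l (suc a) (ℕₚ.<⇒≤ l<m) (s≤s (2*≤1+2*⇒≤ _ a (ℕₚ.≤-pred lb)))
                       (ℕₚ.*-cancelˡ-≤ 2 (ℕₚ.≤-trans (ℕₚ.≤-reflexive (ℕₚ.*-suc 2 a)) ub))
  ...   | z , z∈A , cz with e₄-realised
  ...     | y , y∈A , cy = B z y , subst (λ s → InA B v₀ s (B z y)) (3*-next-level l) (step z∈A y∈A) ,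
                           B-node-e₄ a (ℕₚ.≤-trans (2≤2^ l) (2*≤1+2*⇒≤ _ a (ℕₚ.≤-pred lb))) cz cy

  leaf-realised : ∀ a → Realised (3 * m) (δ (leaf a)) 0ᵛ
  leaf-realised a = node-realised (suc m₀) (leaf a) ℕₚ.≤-refl (2ᵐ<leaf a) (leaf≤k a)

  word-realised : ∀ r (w : Vec (Fin 2ᵐ) (suc r)) → Realised (suc (3 * m * suc r)) 0ʰ (matVec (wordProd M w) (e′ i))
  word-realised zero (a ∷ []) with leaf-realised a
  ... | y , y∈A , cy =
    B v₀ y , subst (λ s → InA B v₀ s (B v₀ y)) (cong suc (≡.sym (ℕₚ.*-identityʳ (3 * m)))) (step base y∈A) ,
    Coords-tail (one-letter-word a)
                (B-by-leaf a Coords-start cy)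
  word-realised (suc r) (a ∷ w) with word-realised r w | leaf-realised a
  ... | x , x∈A , cx | y , y∈A , cy =
    B x y , subst (λ s → InA B v₀ s (B x y)) (1+c*-next (3 * m) r) (step x∈A y∈A) ,
    Coords-tail (λ j → sym (matVec-matMul (M a) (wordProd M w) (e′ i) j)) (B-by-leaf a cx cy)

  realised-represents : ∀ {t D u z} → Realised t D u → Coords D u z → Σ (Vecᴿ (k + n)) λ z′ → InA B v₀ t z′ × z′ ≈ᵛ z
  realised-represents (z′ , z′∈A , cz′) cz = z′ , z′∈A , Coords-unique cz′ cz

  3m≥3 : 3 ≤ 3 * m
  3m≥3 = ℕₚ.*-monoʳ-≤ 3 {1} {m} (s≤s z≤n)

  Shape-vanishes : ∀ {t z} → 3 * m < t → ¬ (3 * m ∣ t ∸ 1) → Shape t z → z ≈ᵛ 0ᵛ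
  Shape-vanishes _ _ (vanishing cz) = Coords-unique cz Coords-0ᵛ
  Shape-vanishes 3m<1 _ (root _) = ⊥-elim (ℕₚ.<⇒≱ 3m<1 (ℕₚ.≤-trans (s≤s z≤n) 3m≥3))
  Shape-vanishes 3m<2 _ (e₂ _) = ⊥-elim (ℕₚ.<⇒≱ 3m<2 (ℕₚ.≤-trans (s≤s (s≤s z≤n)) 3m≥3))
  Shape-vanishes 3m<t _ (node l _ l<m _ _ ≡.refl _) = ⊥-elim (ℕₚ.<⇒≱ 3m<t (ℕₚ.*-monoʳ-≤ 3 l<m))
  Shape-vanishes _ 3m∤t-1 (word r _ ≡.refl _) = ⊥-elim (3m∤t-1 (m∣m*n (suc r)))

  A-vanishes : ∀ t → 3 * m < t → ¬ (3 * m ∣ t ∸ 1) → SetEq (InA B v₀ t) IsZero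
  A-vanishes t 3m<t 3m∤t-1 =
    (λ z z∈A → Shape-vanishes 3m<t 3m∤t-1 (shape z∈A)) ,
    (λ z z≈0 → realised-represents (zero-realised t (ℕₚ.≤-trans (s≤s 3m≥3) 3m<t)) (Coords-≈ (sym ∘ z≈0) Coords-0ᵛ))

  Shape-target : ∀ {t z} r → t ≡ suc (3 * m * suc r) → Shape t z → Target m n M i (suc r) z
  Shape-target r _ (vanishing cz) = inj₂ (Coords-unique cz Coords-0ᵛ)
  Shape-target r () (root _)
  Shape-target r t≡ (e₂ _) = ⊥-elim (3*≢1+3* (m * suc r) 0 (≡.trans (≡.sym (ℕₚ.*-assoc 3 m (suc r))) (≡.sym (ℕₚ.suc-injective t≡))))
  Shape-target r t≡ (node l _ _ _ _ ≡.refl _) = ⊥-elim (3*≢1+3* (suc l) (m * suc r) (≡.trans t≡ (cong suc (ℕₚ.*-assoc 3 m (suc r)))))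
  Shape-target r t≡ (word r′ w t≡′ cz) with ℕₚ.*-cancelˡ-≡ (suc r′) (suc r) (3 * m) (ℕₚ.suc-injective (≡.trans (≡.sym t≡′) t≡))
  ... | ≡.refl = inj₁ (w , Coords-unique cz (Coords-τ _))

  A-words : ∀ r → 1 ≤ r → SetEq (InA B v₀ (3 * m * r + 1)) (Target m n M i r)
  A-words (suc r) _ = (λ z z∈A → Shape-target r t≡ (shape z∈A)) , represent
    where
    t≡ : 3 * m * suc r + 1 ≡ suc (3 * m * suc r)
    t≡ = ℕₚ.+-comm _ 1
    represent : ∀ z → Target m n M i (suc r) z → Σ (Vecᴿ (k + n)) λ z′ → InA B v₀ (3 * m * suc r + 1) z′ × z′ ≈ᵛ z
    represent z (inj₁ (w , z≈)) =
      realised-represents (subst (λ t → Realised t 0ʰ u) (≡.sym t≡) (word-realised r w)) (Coords-≈ (sym ∘ z≈) (Coords-τ u))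
      where u = matVec (wordProd M w) (e′ i)
    represent z (inj₂ z≈0) =
      realised-represents (zero-realised _ (subst (4 ≤_) (≡.sym t≡) (s≤s (ℕₚ.≤-trans 3m≥3 (ℕₚ.m≤m*n (3 * m) (suc r))))))
                          (Coords-≈ (sym ∘ z≈0) Coords-0ᵛ)

mainTheorem5 : ∀ {c ℓ} (R : CommutativeRing c ℓ) (n m : ℕ) → 1 ≤ n → 2 ≤ m →
  (M : Fin (2 ^ m) → WithRing.Mat R n) →
  (B : WithRing.Vecᴿ R (kOf m + n) → WithRing.Vecᴿ R (kOf m + n) → WithRing.Vecᴿ R (kOf m + n)) →
  WithRing.IsB R m n M B →
  (i : Fin n) →
  ((t : ℕ) → 3 * m < t → ¬ (3 * m ∣ t ∸ 1) →
    WithRing.SetEq R (WithRing.InA R B (WithRing.start R m n i) t) (WithRing.IsZero R))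
  × ((r : ℕ) → 1 ≤ r →
    WithRing.SetEq R (WithRing.InA R B (WithRing.start R m n i) (3 * m * r + 1))
      (WithRing.Target R m n M i r))
mainTheorem5 R n (suc (suc m₀)) _ (s≤s (s≤s z≤n)) M B isB i = A-vanishes , A-words
  where open Reachability R n m₀ M B isB i
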